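{- Let $G$ be a passable composite game over a poset $A$, let $a\in A$, and assume that every left option $G^L$ of $G$ satisfies $G^L\le[a]$. Then $G\le[a]$.
   Context: Games over a poset $A$: $[a]$ atomic for $a\in A$; $\{L\mid R\}$ composite for non-empty sets $L,R$ of games (left and right options); atomic games have no options. $G\le H$ iff (1) every $G^L\triangleright H$, (2) every right option $H^R$ of $H$ has $G\triangleright H^R$, (3) if $G$ or $H$ atomic then $G\triangleright H$; $G\triangleright H$ iff (1) some $G^R\le H$, or (2) some left option $H^L$ of $H$ with $G\le H^L$, or (3) $G=[a],H=[b]$ atomic, $a\le b$. $G$ is passable if $G\triangleright G$ and all options of $G$ are passable (recursively). -}

module Defs where

open import Level using (Level; _⊔_) renaming (suc to lsuc; zero to lzero)
open import Data.Product using (Σ; _×_)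
open import Data.Sum using (_⊎_)
open import Relation.Binary.Bundles using (Poset)

-- Games over a poset A.  A composite game {L | R} is given by non-empty
-- families of left and right options: an index type (with a witness of
-- non-emptiness) and a map from indices to games.
module Games {c ℓ₁ ℓ₂ : Level} (A : Poset c ℓ₁ ℓ₂) where
  open Poset A renaming (Carrier to |A|; _≤_ to _≤A_)

  data Game : Set (lsuc lzero ⊔ c) where
    atom : |A| → Game
    comp : (I : Set) → I → (I → Game) →
           (J : Set) → J → (J → Game) → Game

  -- G ≤ H and G ▷ H, defined mutually; clauses unfolded by the shape
  -- (atomic / composite) of G and H.  Atomic games have no options.
  mutual
    _≤G_ : Game → Game → Set (ℓ₂)
    atom a ≤G atom b = atom a ▷ atom b
    atom a ≤G comp I i L J j R = ((y : J) → atom a ▷ R y) × (atom a ▷ comp I i L J j R)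
    comp I i L J j R ≤G atom b = ((x : I) → L x ▷ atom b) × (comp I i L J j R ▷ atom b)
    comp I i L J j R ≤G comp I' i' L' J' j' R' =
      ((x : I) → L x ▷ comp I' i' L' J' j' R') × ((y : J') → comp I i L J j R ▷ R' y)

    _▷_ : Game → Game → Set (ℓ₂)
    atom a ▷ atom b = a ≤A b
    atom a ▷ comp I i L J j R = Σ I (λ x → atom a ≤G L x)
    comp I i L J j R ▷ atom b = Σ J (λ y → R y ≤G atom b)
    comp I i L J j R ▷ comp I' i' L' J' j' R' =
      Σ J (λ y → R y ≤G comp I' i' L' J' j' R') ⊎ Σ I' (λ x → comp I i L J j R ≤G L' x)

  Passable : Game → Set ℓ₂
  Passable (atom a) = atom a ▷ atom a
  Passable (comp I i L J j R) =
    (comp I i L J j R ▷ comp I i L J j R) × ((x : I) → Passable (L x)) × ((y : J) → Passable (R y))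

-- If H ▷ G, then either some right option H^R ≤ G, or H ≤ G^L ≤ [a] for a left
-- option G^L.  Inducting over a passable H, the first case reduces to H^R ≤ G,
-- and H ≤ G together with H ▷ H gives H ▷ G again by transitivity.  Applying
-- this to H = G, whose passability provides G ▷ G, yields a right option
-- G^R ≤ [a], which is the missing clause of G ≤ [a].
module Submission where

open import Defs
open import Level using (Level)
open import Relation.Binary.Bundles using (Poset)
open import Data.Product using (_,_; proj₁; proj₂)
open import Data.Sum using (inj₁; inj₂)

module GameOrder {c ℓ₁ ℓ₂ : Level} (A : Poset c ℓ₁ ℓ₂) where
  open Games A
  open Poset A using (trans) renaming (Carrier to |A|)

  ≤G-leftOption▷ : ∀ {I i J j R} (L : I → Game) K →
                   comp I i L J j R ≤G K → (x : I) → L x ▷ K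
  ≤G-leftOption▷ L (atom _)           = proj₁
  ≤G-leftOption▷ L (comp _ _ _ _ _ _) = proj₁

  ≤G-atom⇒▷ : ∀ H {a} → H ≤G atom a → H ▷ atom a
  ≤G-atom⇒▷ (atom _)           = λ p → p
  ≤G-atom⇒▷ (comp _ _ _ _ _ _) = proj₂

  mutual
    ≤G-trans : ∀ G H K → G ≤G H → H ≤G K → G ≤G K
    ≤G-trans (atom a) (atom b) (atom c) p q = trans p q
    ≤G-trans (atom a) (atom b) K@(comp _ _ _ _ _ R) p q =
      (λ y → ≤G-▷-trans (atom a) (atom b) (R y) p (proj₁ q y)) , ≤G-▷-trans (atom a) (atom b) K p (proj₂ q)
    ≤G-trans (atom a) H@(comp _ _ _ _ _ _) (atom c) p q = ▷-≤G-trans (atom a) H (atom c) (proj₂ p) q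
    ≤G-trans (atom a) H@(comp _ _ _ _ _ _) K@(comp _ _ _ _ _ R) p q =
      (λ y → ≤G-▷-trans (atom a) H (R y) p (proj₂ q y)) , ▷-≤G-trans (atom a) H K (proj₂ p) q
    ≤G-trans G@(comp _ _ L _ _ _) (atom b) (atom c) p q =
      (λ x → ▷-≤G-trans (L x) (atom b) (atom c) (proj₁ p x) q) , ▷-≤G-trans G (atom b) (atom c) (proj₂ p) q
    ≤G-trans G@(comp _ _ L _ _ _) (atom b) K@(comp _ _ _ _ _ R) p q =
      (λ x → ▷-≤G-trans (L x) (atom b) K (proj₁ p x) q) , (λ y → ≤G-▷-trans G (atom b) (R y) p (proj₁ q y))
    ≤G-trans G@(comp _ _ L _ _ _) H@(comp _ _ _ _ _ _) (atom c) p q =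
      (λ x → ▷-≤G-trans (L x) H (atom c) (proj₁ p x) q) , ≤G-▷-trans G H (atom c) p (proj₂ q)
    ≤G-trans G@(comp _ _ L _ _ _) H@(comp _ _ _ _ _ _) K@(comp _ _ _ _ _ R) p q =
      (λ x → ▷-≤G-trans (L x) H K (proj₁ p x) q) , (λ y → ≤G-▷-trans G H (R y) p (proj₂ q y))

    ≤G-▷-trans : ∀ G H K → G ≤G H → H ▷ K → G ▷ K
    ≤G-▷-trans (atom a) (atom b) (atom c) p q = trans p q
    ≤G-▷-trans (atom a) (atom b) (comp _ _ L _ _ _) p (x , r) = x , ≤G-trans (atom a) (atom b) (L x) p r
    ≤G-▷-trans G@(comp _ _ _ _ _ _) (atom b) (comp _ _ L _ _ _) p (x , r) = inj₂ (x , ≤G-trans G (atom b) (L x) p r)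
    ≤G-▷-trans (comp _ _ _ _ _ R) (atom b) (atom c) (_ , (y , r)) q = y , ≤G-trans (R y) (atom b) (atom c) r q
    ≤G-▷-trans (atom a) (comp _ _ _ _ _ R) (atom c) p (y , r) = ▷-≤G-trans (atom a) (R y) (atom c) (proj₁ p y) r
    ≤G-▷-trans G@(comp _ _ _ _ _ _) (comp _ _ _ _ _ R) (atom c) p (y , r) = ▷-≤G-trans G (R y) (atom c) (proj₂ p y) r
    ≤G-▷-trans (atom a) (comp _ _ _ _ _ R) K@(comp _ _ _ _ _ _) p (inj₁ (y , r)) = ▷-≤G-trans (atom a) (R y) K (proj₁ p y) r
    ≤G-▷-trans G@(comp _ _ _ _ _ _) (comp _ _ _ _ _ R) K@(comp _ _ _ _ _ _) p (inj₁ (y , r)) = ▷-≤G-trans G (R y) K (proj₂ p y) r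
    ≤G-▷-trans (atom a) H@(comp _ _ _ _ _ _) (comp _ _ L _ _ _) p (inj₂ (x , r)) = x , ≤G-trans (atom a) H (L x) p r
    ≤G-▷-trans G@(comp _ _ _ _ _ _) H@(comp _ _ _ _ _ _) (comp _ _ L _ _ _) p (inj₂ (x , r)) = inj₂ (x , ≤G-trans G H (L x) p r)

    ▷-≤G-trans : ∀ G H K → G ▷ H → H ≤G K → G ▷ K
    ▷-≤G-trans (atom a) (atom b) (atom c) p q = trans p q
    ▷-≤G-trans (atom a) (atom b) (comp _ _ L _ _ _) p (_ , (x , r)) = x , ≤G-trans (atom a) (atom b) (L x) p r
    ▷-≤G-trans (atom a) (comp _ _ L _ _ _) K (x , r) q = ≤G-▷-trans (atom a) (L x) K r (≤G-leftOption▷ L K q x)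
    ▷-≤G-trans (comp _ _ _ _ _ R) (atom b) (atom c) (y , r) q = y , ≤G-trans (R y) (atom b) (atom c) r q
    ▷-≤G-trans (comp _ _ _ _ _ R) (atom b) K@(comp _ _ _ _ _ _) (y , r) q = inj₁ (y , ≤G-trans (R y) (atom b) K r q)
    ▷-≤G-trans (comp _ _ _ _ _ R) H@(comp _ _ _ _ _ _) (atom c) (inj₁ (y , r)) q = y , ≤G-trans (R y) H (atom c) r q
    ▷-≤G-trans (comp _ _ _ _ _ R) H@(comp _ _ _ _ _ _) K@(comp _ _ _ _ _ _) (inj₁ (y , r)) q = inj₁ (y , ≤G-trans (R y) H K r q)
    ▷-≤G-trans G@(comp _ _ _ _ _ _) (comp _ _ L _ _ _) K (inj₂ (x , r)) q = ≤G-▷-trans G (L x) K r (≤G-leftOption▷ L K q x)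

  module LeftOptionsBelowAtom {I : Set} (i : I) (L : I → Game) {J : Set} (j : J) (R : J → Game)
                              {a : |A|} (L≤a : (x : I) → L x ≤G atom a) where
    G : Game
    G = comp I i L J j R

    ≤leftOption⇒▷atom : ∀ H x → H ≤G L x → H ▷ atom a
    ≤leftOption⇒▷atom H x H≤Lx = ≤G-atom⇒▷ H (≤G-trans H (L x) (atom a) H≤Lx (L≤a x))

    mutual
      passable-≤G⇒≤atom : ∀ H → Passable H → H ≤G G → H ≤G atom a
      passable-≤G⇒≤atom (atom b) pass H≤G = passable-▷⇒▷atom (atom b) pass (proj₂ H≤G)
      passable-≤G⇒≤atom H@(comp _ _ L' _ _ _) pass@(H▷H , passL , _) H≤G =
        (λ x → passable-▷⇒▷atom (L' x) (passL x) (proj₁ H≤G x)) ,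
        passable-▷⇒▷atom H pass (▷-≤G-trans H H G H▷H H≤G)

      passable-▷⇒▷atom : ∀ H → Passable H → H ▷ G → H ▷ atom a
      passable-▷⇒▷atom (atom b) _ (x , H≤Lx) = ≤leftOption⇒▷atom (atom b) x H≤Lx
      passable-▷⇒▷atom (comp _ _ _ _ _ R') (_ , _ , passR) (inj₁ (y , R'y≤G)) =
        y , passable-≤G⇒≤atom (R' y) (passR y) R'y≤G
      passable-▷⇒▷atom H@(comp _ _ _ _ _ _) _ (inj₂ (x , H≤Lx)) = ≤leftOption⇒▷atom H x H≤Lx

proposition6p13 : {c ℓ₁ ℓ₂ : Level} (A : Poset c ℓ₁ ℓ₂) →
    let open Games A in
    (I : Set) (i : I) (L : I → Game) (J : Set) (j : J) (R : J → Game) (a : Poset.Carrier A) →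
    Passable (comp I i L J j R) →
    ((x : I) → L x ≤G atom a) →
    comp I i L J j R ≤G atom a
proposition6p13 A I i L J j R a pass@(G▷G , _) L≤a =
  (λ x → ≤G-atom⇒▷ (L x) (L≤a x)) , passable-▷⇒▷atom G pass G▷G
  where
  open GameOrder A
  open LeftOptionsBelowAtom i L j R L≤a
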